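{- Let $D_n=\langle x,a\mid x^n=a^2=e,\ ax=x^{ -1}a\rangle$ and $C_n=\langle x\rangle$. Let $X\subseteq C_n\setminus\{e\}$ and let $\mu,\lambda,t$ be integers. Then the Cayley graph $\mathcal{C}(D_n,X\cup Xa)$ is a directed strongly regular graph with parameters $(2n,2|X|,\mu,\lambda,t)$ if and only if $t=\mu$ and, in $\mathbb{Z}[C_n]$, $$(\overline{X}+\overline{X^{(-1)}})\overline{X}=(\lambda-\mu)\overline{X}+\mu\overline{C_n}.$$
   Context: $Xa=\{ga:g\in X\}$, $X^{(-1)}=\{g^{ -1}:g\in X\}$, and for $U\subseteq C_n$, $\overline{U}=\sum_{u\in U}u\in\mathbb{Z}[C_n]$. For $S\subseteq G\setminus\{e\}$, the Cayley graph $\mathcal{C}(G,S)$ has vertex set $G$ and an arc $u\to w$ iff $wu^{ -1}\in S$. A directed graph on $N$ vertices with $0/1$ adjacency matrix $A$ (zero diagonal) is a directed strongly regular graph with parameters $(N,k,\mu,\lambda,t)$ if $JA=AJ=kJ$ and $A^2=tI+\lambda A+\mu(J-I-A)$. -}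

module Defs where

open import Data.Nat as ℕ using (ℕ; NonZero)
open import Data.Nat.DivMod using (_mod_)
open import Data.Fin using (Fin; toℕ)
open import Data.Fin.Subset using (Subset; _∈_; _∉_; ∣_∣)
open import Data.Bool using (Bool; true; false; if_then_else_; _xor_)
open import Data.Product using (_×_; _,_)
open import Data.List using (List; []; _∷_; foldr; map; concatMap; allFin; length)
open import Data.Integer using (ℤ; +_; _+_; _-_; _*_)
open import Data.Vec using (lookup)
open import Relation.Binary.PropositionalEquality using (_≡_)
open import Relation.Binary.Definitions using (DecidableEquality)
open import Relation.Nullary using (does)

Σℤ : {V : Set} → List V → (V → ℤ) → ℤ
Σℤ vs f = foldr (λ v s → f v + s) (+ 0) vs

-- Directed strongly regular graphs (N, k, μ, λ, t).
-- Vertex set V enumerated (without repetition) by the list vs;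
-- A is the (0/1, zero-diagonal) adjacency matrix as a function V → V → ℤ.

δ : {V : Set} → DecidableEquality V → V → V → ℤ
δ _≟_ u w = if does (u ≟ w) then + 1 else + 0

record IsDSRG {V : Set} (_≟_ : DecidableEquality V) (vs : List V)
              (A : V → V → ℤ) (N : ℕ) (k μ lam t : ℤ) : Set where
  field
    nVertices : length vs ≡ N
    colSum    : ∀ w → Σℤ vs (λ v → A v w) ≡ k
    rowSum    : ∀ u → Σℤ vs (λ v → A u v) ≡ k
    square    : ∀ u w → Σℤ vs (λ v → A u v * A v w)
                  ≡ t * δ _≟_ u w + lam * A u w
                    + μ * (+ 1 - δ _≟_ u w - A u w)

-- Cyclic group C_n = ⟨x⟩, x^i ↦ i : Fin n (exponents mod n)

module _ {n : ℕ} .{{_ : NonZero n}} where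

  eC : Fin n
  eC = 0 mod n

  addC : Fin n → Fin n → Fin n
  addC i j = (toℕ i ℕ.+ toℕ j) mod n

  negC : Fin n → Fin n
  negC i = (n ℕ.∸ toℕ i) mod n

-- Dihedral group D_n = ⟨x, a | x^n = a^2 = e, a x = x^{-1} a⟩ of order 2n.
-- (i , b) represents x^i a^b  (b = true means the factor a is present).

D : ℕ → Set
D n = Fin n × Bool

module _ {n : ℕ} .{{_ : NonZero n}} where

  -- (x^i a^b)(x^j a^c) = x^{i ± j} a^{b xor c}, since a x^j = x^{-j} a
  mulD : D n → D n → D n
  mulD (i , b) (j , c) = addC i (if b then negC j else j) , (b xor c)

  invD : D n → D n
  invD (i , false) = negC i , false
  invD (i , true)  = i , true

  elemsD : List (D n)
  elemsD = concatMap (λ i → (i , false) ∷ (i , true) ∷ []) (allFin n)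

_≟D_ : {n : ℕ} → DecidableEquality (D n)
_≟D_ = Data.Product.Properties.≡-dec Data.Fin._≟_ Data.Bool._≟_
  where import Data.Product.Properties
        import Data.Fin
        import Data.Bool

module _ {n : ℕ} .{{_ : NonZero n}} where

  -- Connection set S = X ∪ Xa : x^i a^b ∈ S iff x^i ∈ X
  inS : Subset n → D n → Bool
  inS X (i , _) = lookup X i

  cayleyAdj : Subset n → D n → D n → ℤ
  cayleyAdj X u w = if inS X (mulD w (invD u)) then + 1 else + 0

-- Group ring ℤ[C_n]: elements are coefficient functions Fin n → ℤ

ZC : ℕ → Set
ZC n = Fin n → ℤ

module _ {n : ℕ} .{{_ : NonZero n}} where

  _+ᶻ_ : ZC n → ZC n → ZC n
  (f +ᶻ g) i = f i + g i

  _*ᶻ_ : ZC n → ZC n → ZC n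
  (f *ᶻ g) k = Σℤ (allFin n) (λ i → f i * g (addC k (negC i)))

  scaleᶻ : ℤ → ZC n → ZC n
  scaleᶻ c f i = c * f i

  bar : Subset n → ZC n
  bar U i = if lookup U i then + 1 else + 0

  barInv : Subset n → ZC n
  barInv U i = bar U (negC i)

  barC : ZC n
  barC _ = + 1

-- Label each arc u → w of C(D_n, X ∪ Xa) by the C_n-component ℓ of w u⁻¹; the arc exists iff ℓ ∈ X, and the
-- (u, w) entry of A² counts the two-step walks u → v → w.  Splitting the middle vertex v over the cosets C_n and
-- C_n a and reindexing by translations and inversions of C_n, the two halves are the coefficients at ℓ of X̄ X̄ and
-- of X̄^(-1) X̄, so A²(u, w) = ((X̄ + X̄^(-1)) X̄)(ℓ).  An entry with u and w in different cosets has δ = 0 and label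
-- an arbitrary k, which turns the DSRG identity into the group ring identity; the diagonal entry at e, where
-- X̄(e) = 0 because e ∉ X, then forces t = μ.  Conversely, once t = μ the δ-terms cancel from the DSRG identity.
-- Row and column sums are 2|X| because every row and column meets each coset in a translate or reflection of X.

module Submission where

open import Defs
open import Level using (0ℓ)
open import Function.Base using (_∘_; id)
open import Function.Bundles using (_⇔_; mk⇔)
open import Data.Bool using (Bool; true; false; if_then_else_)
open import Data.Product using (_×_; _,_; proj₁)
open import Data.Nat as ℕ using (ℕ; NonZero; suc; _%_)
import Data.Nat.Properties as ℕ
open import Data.Nat.DivMod using (_mod_; m%n<n; %-distribˡ-+; m%n%n≡m%n; m<n⇒m%n≡m; n%n≡0)
open import Data.Fin as Fin using (Fin; toℕ)
open import Data.Fin.Properties using (toℕ-fromℕ<; toℕ-injective; toℕ<n; toℕ≤n)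
open import Data.Fin.Permutation using (Permutation′; permutation; _⟨$⟩ʳ_)
open import Data.Fin.Subset using (Subset; _∉_; ∣_∣)
open import Data.Vec using (_∷_; []; lookup)
open import Data.Vec.Properties using (lookup⇒[]=)
open import Data.List using (List; []; _∷_; tabulate; allFin; concatMap; length)
import Data.List.Properties as List
open import Data.Integer using (ℤ; +_; _+_; _-_; _*_)
import Data.Integer as ℤ
import Data.Integer.Properties as ℤ
open import Data.Integer.Tactic.RingSolver using (solve-∀)
open import Algebra.Bundles using (AbelianGroup)
open import Algebra.Structures using (IsAbelianGroup)
open import Algebra.Consequences.Propositional using (comm∧idʳ⇒id; comm∧invʳ⇒inv)
open import Algebra.Properties.CommutativeMonoid.Sum ℤ.+-0-commutativeMonoid
  using (sum; sum-permute; ∑-distrib-+)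
open import Relation.Nullary.Decidable using (dec-true; dec-false)
open import Relation.Nullary.Negation using (contradiction)
open import Relation.Binary.PropositionalEquality
open ≡-Reasoning

module _ {n : ℕ} .{{_ : NonZero n}} where

  toℕ-mod : ∀ a → toℕ (a mod n) ≡ a % n
  toℕ-mod a = toℕ-fromℕ< (m%n<n a n)

  %-absorbʳ : ∀ a b → (a ℕ.+ b % n) % n ≡ (a ℕ.+ b) % n
  %-absorbʳ a b = begin
    (a ℕ.+ b % n) % n         ≡⟨ %-distribˡ-+ a (b % n) n ⟩
    (a % n ℕ.+ b % n % n) % n ≡⟨ cong (λ r → (a % n ℕ.+ r) % n) (m%n%n≡m%n b n) ⟩
    (a % n ℕ.+ b % n) % n     ≡⟨ %-distribˡ-+ a b n ⟨
    (a ℕ.+ b) % n             ∎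

  toℕ-addC : ∀ (i j : Fin n) → toℕ (addC i j) ≡ (toℕ i ℕ.+ toℕ j) % n
  toℕ-addC i j = toℕ-mod _

  addC-comm : ∀ (i j : Fin n) → addC i j ≡ addC j i
  addC-comm i j = cong (_mod n) (ℕ.+-comm (toℕ i) (toℕ j))

  addC-assoc : ∀ (i j k : Fin n) → addC (addC i j) k ≡ addC i (addC j k)
  addC-assoc i j k = toℕ-injective (begin
    toℕ (addC (addC i j) k)               ≡⟨ toℕ-addC _ k ⟩
    (toℕ (addC i j) ℕ.+ toℕ k) % n        ≡⟨ cong (λ r → (r ℕ.+ toℕ k) % n) (toℕ-addC i j) ⟩
    ((toℕ i ℕ.+ toℕ j) % n ℕ.+ toℕ k) % n ≡⟨ cong (_% n) (ℕ.+-comm _ (toℕ k)) ⟩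
    (toℕ k ℕ.+ (toℕ i ℕ.+ toℕ j) % n) % n ≡⟨ %-absorbʳ (toℕ k) _ ⟩
    (toℕ k ℕ.+ (toℕ i ℕ.+ toℕ j)) % n     ≡⟨ cong (_% n) (trans (ℕ.+-comm (toℕ k) _) (ℕ.+-assoc (toℕ i) _ _)) ⟩
    (toℕ i ℕ.+ (toℕ j ℕ.+ toℕ k)) % n     ≡⟨ %-absorbʳ (toℕ i) _ ⟨
    (toℕ i ℕ.+ (toℕ j ℕ.+ toℕ k) % n) % n ≡⟨ cong (λ r → (toℕ i ℕ.+ r) % n) (toℕ-addC j k) ⟨
    (toℕ i ℕ.+ toℕ (addC j k)) % n        ≡⟨ toℕ-addC i _ ⟨
    toℕ (addC i (addC j k))               ∎)

  toℕ-eC : toℕ (eC {n}) ≡ 0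
  toℕ-eC = trans (toℕ-mod 0) (m<n⇒m%n≡m (ℕ.>-nonZero⁻¹ n))

  addC-identityʳ : ∀ (i : Fin n) → addC i eC ≡ i
  addC-identityʳ i = toℕ-injective (begin
    toℕ (addC i eC)              ≡⟨ toℕ-addC i eC ⟩
    (toℕ i ℕ.+ toℕ (eC {n})) % n ≡⟨ cong (λ r → (toℕ i ℕ.+ r) % n) toℕ-eC ⟩
    (toℕ i ℕ.+ 0) % n            ≡⟨ cong (_% n) (ℕ.+-identityʳ (toℕ i)) ⟩
    toℕ i % n                    ≡⟨ m<n⇒m%n≡m (toℕ<n i) ⟩
    toℕ i                        ∎)

  addC-inverseʳ : ∀ (i : Fin n) → addC i (negC i) ≡ eC
  addC-inverseʳ i = toℕ-injective (begin
    toℕ (addC i (negC i))             ≡⟨ toℕ-addC i _ ⟩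
    (toℕ i ℕ.+ toℕ (negC i)) % n      ≡⟨ cong (λ r → (toℕ i ℕ.+ r) % n) (toℕ-mod _) ⟩
    (toℕ i ℕ.+ (n ℕ.∸ toℕ i) % n) % n ≡⟨ %-absorbʳ (toℕ i) _ ⟩
    (toℕ i ℕ.+ (n ℕ.∸ toℕ i)) % n     ≡⟨ cong (_% n) (ℕ.m+[n∸m]≡n (toℕ≤n i)) ⟩
    n % n                             ≡⟨ n%n≡0 n ⟩
    0                                 ≡⟨ toℕ-eC ⟨
    toℕ (eC {n})                      ∎)

  isAbelianGroup : IsAbelianGroup _≡_ addC eC negC
  isAbelianGroup = record
    { isGroup = record
      { isMonoid = record
        { isSemigroup = record
          { isMagma = record { isEquivalence = isEquivalence ; ∙-cong = cong₂ addC }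
          ; assoc = addC-assoc }
        ; identity = comm∧idʳ⇒id addC-comm addC-identityʳ }
      ; inverse = comm∧invʳ⇒inv addC-comm addC-inverseʳ
      ; ⁻¹-cong = cong negC }
    ; comm = addC-comm }

cyclicGroup : (n : ℕ) .{{_ : NonZero n}} → AbelianGroup 0ℓ 0ℓ
cyclicGroup n = record { isAbelianGroup = isAbelianGroup {n} }

Σℤ-cong : {V : Set} (vs : List V) {f g : V → ℤ} → (∀ v → f v ≡ g v) → Σℤ vs f ≡ Σℤ vs g
Σℤ-cong []       f≗g = refl
Σℤ-cong (v ∷ vs) f≗g = cong₂ _+_ (f≗g v) (Σℤ-cong vs f≗g)

Σℤ-tabulate : {V : Set} {n : ℕ} (g : Fin n → V) (f : V → ℤ) → Σℤ (tabulate g) f ≡ sum (f ∘ g)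
Σℤ-tabulate {n = ℕ.zero} g f = refl
Σℤ-tabulate {n = suc n}  g f = cong (λ s → f (g Fin.zero) + s) (Σℤ-tabulate (g ∘ Fin.suc) f)

module _ {n : ℕ} where

  Σℤ-allFin : (f : Fin n → ℤ) → Σℤ (allFin n) f ≡ sum f
  Σℤ-allFin = Σℤ-tabulate id

  Σℤ-allFin-distrib : (f g : Fin n → ℤ) →
    Σℤ (allFin n) (λ i → f i + g i) ≡ Σℤ (allFin n) f + Σℤ (allFin n) g
  Σℤ-allFin-distrib f g = begin
    Σℤ (allFin n) (λ i → f i + g i)   ≡⟨ Σℤ-allFin _ ⟩
    sum (λ i → f i + g i)             ≡⟨ ∑-distrib-+ f g ⟩
    sum f + sum g                     ≡⟨ cong₂ _+_ (Σℤ-allFin f) (Σℤ-allFin g) ⟨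
    Σℤ (allFin n) f + Σℤ (allFin n) g ∎

  Σℤ-allFin-permute : (π : Permutation′ n) (f : Fin n → ℤ) →
    Σℤ (allFin n) (f ∘ (π ⟨$⟩ʳ_)) ≡ Σℤ (allFin n) f
  Σℤ-allFin-permute π f = begin
    Σℤ (allFin n) (f ∘ (π ⟨$⟩ʳ_)) ≡⟨ Σℤ-allFin _ ⟩
    sum (f ∘ (π ⟨$⟩ʳ_))           ≡⟨ sum-permute f π ⟨
    sum f                         ≡⟨ Σℤ-allFin f ⟨
    Σℤ (allFin n) f               ∎

module _ {n : ℕ} .{{_ : NonZero n}} where

  open AbelianGroup (cyclicGroup n) using (_∙_; _⁻¹; comm; assoc)
  open import Algebra.Properties.AbelianGroup (cyclicGroup n)
    using (⁻¹-involutive; ⁻¹-anti-homo-∙; //-rightDividesˡ; //-rightDividesʳ)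
  open import Algebra.Properties.CommutativeSemigroup (AbelianGroup.commutativeSemigroup (cyclicGroup n))
    using (x∙yz≈xz∙y)

  Σℤ-translate : ∀ a (f : Fin n → ℤ) → Σℤ (allFin n) (λ m → f (m ∙ a)) ≡ Σℤ (allFin n) f
  Σℤ-translate a = Σℤ-allFin-permute (permutation (_∙ a) (_∙ a ⁻¹) (//-rightDividesˡ a) (//-rightDividesʳ a))

  Σℤ-invert : ∀ (f : Fin n → ℤ) → Σℤ (allFin n) (λ m → f (m ⁻¹)) ≡ Σℤ (allFin n) f
  Σℤ-invert = Σℤ-allFin-permute (permutation _⁻¹ _⁻¹ ⁻¹-involutive ⁻¹-involutive)

  Σℤ-translateˡ : ∀ a (f : Fin n → ℤ) → Σℤ (allFin n) (λ m → f (a ∙ m)) ≡ Σℤ (allFin n) f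
  Σℤ-translateˡ a f = trans (Σℤ-cong (allFin n) (λ m → cong f (comm a m))) (Σℤ-translate a f)

  Σℤ-reflect : ∀ a (f : Fin n → ℤ) → Σℤ (allFin n) (λ m → f (a ∙ m ⁻¹)) ≡ Σℤ (allFin n) f
  Σℤ-reflect a f = trans (Σℤ-invert (λ m → f (a ∙ m))) (Σℤ-translateˡ a f)

  *ᶻ-distribʳ-+ᶻ : ∀ (f g h : ZC n) k → ((f +ᶻ g) *ᶻ h) k ≡ (f *ᶻ h) k + (g *ᶻ h) k
  *ᶻ-distribʳ-+ᶻ f g h k = trans
    (Σℤ-cong (allFin n) (λ i → ℤ.*-distribʳ-+ (h (k ∙ i ⁻¹)) (f i) (g i)))
    (Σℤ-allFin-distrib (λ i → f i * h (k ∙ i ⁻¹)) (λ i → g i * h (k ∙ i ⁻¹)))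

  *ᶻ-translate : ∀ (f g : ZC n) a k →
    Σℤ (allFin n) (λ m → f (m ∙ a) * g (k ∙ m ⁻¹)) ≡ (f *ᶻ g) (k ∙ a)
  *ᶻ-translate f g a k = begin
    Σℤ (allFin n) (λ m → f (m ∙ a) * g (k ∙ m ⁻¹))
      ≡⟨ Σℤ-translate (a ⁻¹) (λ m → f (m ∙ a) * g (k ∙ m ⁻¹)) ⟨
    Σℤ (allFin n) (λ m → f (m ∙ a ⁻¹ ∙ a) * g (k ∙ (m ∙ a ⁻¹) ⁻¹))
      ≡⟨ Σℤ-cong (allFin n) (λ m → cong₂ _*_ (cong f (//-rightDividesˡ a m)) (cong g (shift m))) ⟩
    Σℤ (allFin n) (λ m → f m * g (k ∙ a ∙ m ⁻¹)) ∎
    where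
    shift : ∀ m → k ∙ (m ∙ a ⁻¹) ⁻¹ ≡ k ∙ a ∙ m ⁻¹
    shift m = begin
      k ∙ (m ∙ a ⁻¹) ⁻¹     ≡⟨ cong (k ∙_) (⁻¹-anti-homo-∙ m (a ⁻¹)) ⟩
      k ∙ (a ⁻¹ ⁻¹ ∙ m ⁻¹)  ≡⟨ cong (λ b → k ∙ (b ∙ m ⁻¹)) (⁻¹-involutive a) ⟩
      k ∙ (a ∙ m ⁻¹)        ≡⟨ assoc k a (m ⁻¹) ⟨
      k ∙ a ∙ m ⁻¹          ∎

  *ᶻ-reflect : ∀ (f g : ZC n) a k →
    Σℤ (allFin n) (λ m → f (m ∙ a) * g (k ∙ m)) ≡ ((f ∘ _⁻¹) *ᶻ g) (k ∙ a ⁻¹)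
  *ᶻ-reflect f g a k = begin
    Σℤ (allFin n) (λ m → f (m ∙ a) * g (k ∙ m))
      ≡⟨ Σℤ-translate (a ⁻¹) (λ m → f (m ∙ a) * g (k ∙ m)) ⟨
    Σℤ (allFin n) (λ m → f (m ∙ a ⁻¹ ∙ a) * g (k ∙ (m ∙ a ⁻¹)))
      ≡⟨ Σℤ-invert (λ m → f (m ∙ a ⁻¹ ∙ a) * g (k ∙ (m ∙ a ⁻¹))) ⟨
    Σℤ (allFin n) (λ m → f (m ⁻¹ ∙ a ⁻¹ ∙ a) * g (k ∙ (m ⁻¹ ∙ a ⁻¹)))
      ≡⟨ Σℤ-cong (allFin n) (λ m → cong₂ _*_
           (cong f (//-rightDividesˡ a (m ⁻¹))) (cong g (x∙yz≈xz∙y k (m ⁻¹) (a ⁻¹)))) ⟩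
    Σℤ (allFin n) (λ m → f (m ⁻¹) * g (k ∙ a ⁻¹ ∙ m ⁻¹)) ∎

Σℤ-concatMap-pair : {A V : Set} (g h : A → V) (as : List A) (F : V → ℤ) →
  Σℤ (concatMap (λ a → g a ∷ h a ∷ []) as) F ≡ Σℤ as (λ a → F (g a) + F (h a))
Σℤ-concatMap-pair g h []       F = refl
Σℤ-concatMap-pair g h (a ∷ as) F = begin
  F (g a) + (F (h a) + Σℤ (concatMap pair as) F) ≡⟨ cong (λ s → F (g a) + (F (h a) + s)) (Σℤ-concatMap-pair g h as F) ⟩
  F (g a) + (F (h a) + Σℤ as F∘pair)             ≡⟨ ℤ.+-assoc (F (g a)) (F (h a)) _ ⟨
  F (g a) + F (h a) + Σℤ as F∘pair               ∎
  where
  pair : _ → List _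
  pair a = g a ∷ h a ∷ []
  F∘pair : _ → ℤ
  F∘pair a = F (g a) + F (h a)

length-concatMap-pair : {A V : Set} (g h : A → V) (as : List A) →
  length (concatMap (λ a → g a ∷ h a ∷ []) as) ≡ 2 ℕ.* length as
length-concatMap-pair g h []       = refl
length-concatMap-pair g h (a ∷ as) = begin
  suc (suc (length (concatMap (λ a → g a ∷ h a ∷ []) as))) ≡⟨ cong (suc ∘ suc) (length-concatMap-pair g h as) ⟩
  suc (suc (2 ℕ.* length as))                              ≡⟨ ℕ.*-distribˡ-+ 2 1 (length as) ⟨
  2 ℕ.* suc (length as)                                    ∎

+m++m≡+[2*m] : ∀ m → + m + + m ≡ + (2 ℕ.* m)
+m++m≡+[2*m] m = cong +_ (cong (m ℕ.+_) (sym (ℕ.+-identityʳ m)))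

Σℤ-indicator : ∀ {n} (X : Subset n) → Σℤ (allFin n) (λ i → if lookup X i then + 1 else + 0) ≡ + ∣ X ∣
Σℤ-indicator {n} X = trans (Σℤ-allFin {n} _) (sum-indicator X)
  where
  sum-indicator : ∀ {n} (X : Subset n) → sum (λ i → if lookup X i then + 1 else + 0) ≡ + ∣ X ∣
  sum-indicator []          = refl
  sum-indicator (true ∷ X)  = cong (λ s → + 1 + s) (sum-indicator X)
  sum-indicator (false ∷ X) = trans (cong (λ s → + 0 + s) (sum-indicator X)) (ℤ.+-identityˡ _)

module _ {n : ℕ} .{{_ : NonZero n}} where

  open AbelianGroup (cyclicGroup n) using (_∙_; _⁻¹)
  open import Algebra.Properties.AbelianGroup (cyclicGroup n) using (⁻¹-involutive)

  Σℤ-elemsD : (F : D n → ℤ) →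
    Σℤ elemsD F ≡ Σℤ (allFin n) (λ m → F (m , false)) + Σℤ (allFin n) (λ m → F (m , true))
  Σℤ-elemsD F = trans (Σℤ-concatMap-pair (_, false) (_, true) (allFin n) F)
                      (Σℤ-allFin-distrib (λ m → F (m , false)) (λ m → F (m , true)))

  length-elemsD : length (elemsD {n}) ≡ 2 ℕ.* n
  length-elemsD = trans (length-concatMap-pair (_, false) (_, true) (allFin n))
                        (cong (2 ℕ.*_) (List.length-tabulate {n = n} id))

  -- The C_n-component of w u⁻¹; cayleyAdj X u w reduces to bar X (arcLabel u w), which is used silently below.
  arcLabel : D n → D n → Fin n
  arcLabel u w = proj₁ (mulD w (invD u))

  module _ (X : Subset n) where

    private
      x : ZC n
      x = bar X

    Σℤ-bar-translate : ∀ a → Σℤ (allFin n) (λ m → x (m ∙ a)) ≡ + ∣ X ∣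
    Σℤ-bar-translate a = trans (Σℤ-translate a x) (Σℤ-indicator X)

    Σℤ-bar-translateˡ : ∀ a → Σℤ (allFin n) (λ m → x (a ∙ m)) ≡ + ∣ X ∣
    Σℤ-bar-translateˡ a = trans (Σℤ-translateˡ a x) (Σℤ-indicator X)

    Σℤ-bar-reflect : ∀ a → Σℤ (allFin n) (λ m → x (a ∙ m ⁻¹)) ≡ + ∣ X ∣
    Σℤ-bar-reflect a = trans (Σℤ-reflect a x) (Σℤ-indicator X)

    Σℤ-elemsD-regular : (F : D n → ℤ) →
      Σℤ (allFin n) (λ m → F (m , false)) ≡ + ∣ X ∣ →
      Σℤ (allFin n) (λ m → F (m , true)) ≡ + ∣ X ∣ →
      Σℤ elemsD F ≡ + (2 ℕ.* ∣ X ∣)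
    Σℤ-elemsD-regular F sheet₀ sheet₁ =
      trans (Σℤ-elemsD F) (trans (cong₂ _+_ sheet₀ sheet₁) (+m++m≡+[2*m] ∣ X ∣))

    cayleyAdj-rowSum : ∀ u → Σℤ elemsD (cayleyAdj X u) ≡ + (2 ℕ.* ∣ X ∣)
    cayleyAdj-rowSum (i , false) =
      Σℤ-elemsD-regular (cayleyAdj X (i , false)) (Σℤ-bar-translate (i ⁻¹)) (Σℤ-bar-translate (i ⁻¹ ⁻¹))
    cayleyAdj-rowSum (i , true) =
      Σℤ-elemsD-regular (cayleyAdj X (i , true)) (Σℤ-bar-translate i) (Σℤ-bar-translate (i ⁻¹))

    cayleyAdj-colSum : ∀ w → Σℤ elemsD (λ v → cayleyAdj X v w) ≡ + (2 ℕ.* ∣ X ∣)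
    cayleyAdj-colSum (j , false) =
      Σℤ-elemsD-regular (λ v → cayleyAdj X v (j , false)) (Σℤ-bar-reflect j) (Σℤ-bar-translateˡ j)
    cayleyAdj-colSum (j , true) =
      Σℤ-elemsD-regular (λ v → cayleyAdj X v (j , true))
        (trans (Σℤ-cong (allFin n) (λ m → cong (λ b → x (j ∙ b)) (⁻¹-involutive m))) (Σℤ-bar-translateˡ j))
        (Σℤ-bar-reflect j)

    cayleyAdj-square : ∀ u w →
      Σℤ elemsD (λ v → cayleyAdj X u v * cayleyAdj X v w) ≡ ((x +ᶻ barInv X) *ᶻ x) (arcLabel u w)
    cayleyAdj-square u w = begin
      Σℤ elemsD (λ v → A u v * A v w)                          ≡⟨ Σℤ-elemsD (λ v → A u v * A v w) ⟩
      twoStepsVia false u w + twoStepsVia true u w             ≡⟨ sheetContributions u w ⟩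
      (x *ᶻ x) (arcLabel u w) + (barInv X *ᶻ x) (arcLabel u w) ≡⟨ *ᶻ-distribʳ-+ᶻ x (barInv X) x _ ⟨
      ((x +ᶻ barInv X) *ᶻ x) (arcLabel u w)                    ∎
      where
      A = cayleyAdj X

      twoStepsVia : Bool → D n → D n → ℤ
      twoStepsVia b u w = Σℤ (allFin n) (λ m → A u (m , b) * A (m , b) w)

      *ᶻ-reflect-doubleInverse : ∀ a k →
        Σℤ (allFin n) (λ m → x (m ∙ a) * x (k ∙ m ⁻¹ ⁻¹)) ≡ (barInv X *ᶻ x) (k ∙ a ⁻¹)
      *ᶻ-reflect-doubleInverse a k = trans
        (Σℤ-cong (allFin n) (λ m → cong (λ b → x (m ∙ a) * x (k ∙ b)) (⁻¹-involutive m)))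
        (*ᶻ-reflect x x a k)

      *ᶻ-reflect-inverse : ∀ a k →
        Σℤ (allFin n) (λ m → x (m ∙ a ⁻¹) * x (k ∙ m)) ≡ (barInv X *ᶻ x) (k ∙ a)
      *ᶻ-reflect-inverse a k = trans
        (*ᶻ-reflect x x (a ⁻¹) k)
        (cong (λ b → (barInv X *ᶻ x) (k ∙ b)) (⁻¹-involutive a))

      -- When w lies in the coset C_n a, the walks through C_n a give X̄ X̄ and those through C_n give X̄^(-1) X̄.
      sheetContributions : ∀ u w →
        twoStepsVia false u w + twoStepsVia true u w ≡ (x *ᶻ x) (arcLabel u w) + (barInv X *ᶻ x) (arcLabel u w)
      sheetContributions (i , false) (j , false) =
        cong₂ _+_ (*ᶻ-translate x x (i ⁻¹) j) (*ᶻ-reflect-inverse (i ⁻¹) j)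
      sheetContributions (i , false) (j , true) = trans (ℤ.+-comm (twoStepsVia false (i , false) (j , true)) _)
        (cong₂ _+_ (*ᶻ-translate x x (i ⁻¹ ⁻¹) j) (*ᶻ-reflect-doubleInverse (i ⁻¹) j))
      sheetContributions (i , true) (j , false) =
        cong₂ _+_ (*ᶻ-translate x x i j) (*ᶻ-reflect-inverse i j)
      sheetContributions (i , true) (j , true) = trans (ℤ.+-comm (twoStepsVia false (i , true) (j , true)) _)
        (cong₂ _+_ (*ᶻ-translate x x (i ⁻¹) j) (*ᶻ-reflect-doubleInverse i j))

δ-refl : ∀ {n} (u : D n) → δ _≟D_ u u ≡ + 1
δ-refl u = cong (λ b → if b then + 1 else + 0) (dec-true (u ≟D u) refl)

δ-distinct-sheets : ∀ {n} (i j : Fin n) → δ _≟D_ (i , true) (j , false) ≡ + 0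
δ-distinct-sheets i j = cong (λ b → if b then + 1 else + 0) (dec-false ((i , true) ≟D (j , false)) (λ ()))

bar-∉ : ∀ {n} .{{_ : NonZero n}} {X : Subset n} {i} → i ∉ X → bar X i ≡ + 0
bar-∉ {X = X} {i} i∉X with lookup X i in eq
... | true  = contradiction (lookup⇒[]= i X eq) i∉X
... | false = refl

module _ {n : ℕ} .{{_ : NonZero n}} (X : Subset n) (μ lam t : ℤ) where

  open AbelianGroup (cyclicGroup n) using (_∙_; _⁻¹; ε; identityʳ; inverseʳ)

  private
    x P : ZC n
    x = bar X
    P = (bar X +ᶻ barInv X) *ᶻ bar X

    IsCayleyDSRG : Set
    IsCayleyDSRG = IsDSRG _≟D_ elemsD (cayleyAdj X) (2 ℕ.* n) (+ (2 ℕ.* ∣ X ∣)) μ lam t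

  dsrg⇒square-entry : IsCayleyDSRG → ∀ u w →
    P (arcLabel u w) ≡ t * δ _≟D_ u w + lam * x (arcLabel u w) + μ * (+ 1 - δ _≟D_ u w - x (arcLabel u w))
  dsrg⇒square-entry G u w = trans (sym (cayleyAdj-square X u w)) (IsDSRG.square G u w)

  dsrg⇒groupRingEquation : IsCayleyDSRG → ∀ k → P k ≡ (lam - μ) * x k + μ * + 1
  dsrg⇒groupRingEquation G k = begin
    P k                                                        ≡⟨ cong P (identityʳ k) ⟨
    P (k ∙ ε)                                                  ≡⟨ dsrg⇒square-entry G (ε , true) (k , false) ⟩
    t * δ _≟D_ (ε , true) (k , false) + lam * x (k ∙ ε)
      + μ * (+ 1 - δ _≟D_ (ε , true) (k , false) - x (k ∙ ε))  ≡⟨ cong (λ d → t * d + lam * x (k ∙ ε) + μ * (+ 1 - d - x (k ∙ ε)))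
                                                                      (δ-distinct-sheets ε k) ⟩
    t * + 0 + lam * x (k ∙ ε) + μ * (+ 1 - + 0 - x (k ∙ ε))    ≡⟨ off-diagonal t lam μ (x (k ∙ ε)) ⟩
    (lam - μ) * x (k ∙ ε) + μ * + 1                            ≡⟨ cong (λ i → (lam - μ) * x i + μ * + 1) (identityʳ k) ⟩
    (lam - μ) * x k + μ * + 1                                  ∎
    where
    off-diagonal : ∀ t lam μ a → t * + 0 + lam * a + μ * (+ 1 - + 0 - a) ≡ (lam - μ) * a + μ * + 1
    off-diagonal = solve-∀

  dsrg⇒t≡μ : eC ∉ X → IsCayleyDSRG → t ≡ μ
  dsrg⇒t≡μ e∉X G = begin
    t                                                            ≡⟨ diagonal t lam μ ⟨
    t * + 1 + lam * + 0 + μ * (+ 1 - + 1 - + 0)                  ≡⟨ cong₂ (λ d a → t * d + lam * a + μ * (+ 1 - d - a))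
                                                                       (δ-refl (ε , false)) x[ε∙ε⁻¹]≡0 ⟨
    t * δ _≟D_ (ε , false) (ε , false) + lam * x (ε ∙ ε ⁻¹)
      + μ * (+ 1 - δ _≟D_ (ε , false) (ε , false) - x (ε ∙ ε ⁻¹)) ≡⟨ dsrg⇒square-entry G (ε , false) (ε , false) ⟨
    P (ε ∙ ε ⁻¹)                                                 ≡⟨ dsrg⇒groupRingEquation G (ε ∙ ε ⁻¹) ⟩
    (lam - μ) * x (ε ∙ ε ⁻¹) + μ * + 1                           ≡⟨ cong (λ a → (lam - μ) * a + μ * + 1) x[ε∙ε⁻¹]≡0 ⟩
    (lam - μ) * + 0 + μ * + 1                                    ≡⟨ at-identity lam μ ⟩
    μ                                                            ∎
    where
    x[ε∙ε⁻¹]≡0 : x (ε ∙ ε ⁻¹) ≡ + 0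
    x[ε∙ε⁻¹]≡0 = trans (cong x (inverseʳ ε)) (bar-∉ e∉X)

    diagonal : ∀ t lam μ → t * + 1 + lam * + 0 + μ * (+ 1 - + 1 - + 0) ≡ t
    diagonal = solve-∀

    at-identity : ∀ lam μ → (lam - μ) * + 0 + μ * + 1 ≡ μ
    at-identity = solve-∀

  groupRingEquation⇒dsrg : t ≡ μ → (∀ k → P k ≡ (lam - μ) * x k + μ * + 1) → IsCayleyDSRG
  groupRingEquation⇒dsrg refl equation = record
    { nVertices = length-elemsD
    ; colSum    = cayleyAdj-colSum X
    ; rowSum    = cayleyAdj-rowSum X
    ; square    = λ u w → begin
        Σℤ elemsD (λ v → cayleyAdj X u v * cayleyAdj X v w) ≡⟨ cayleyAdj-square X u w ⟩
        P (arcLabel u w)                                     ≡⟨ equation (arcLabel u w) ⟩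
        (lam - μ) * x (arcLabel u w) + μ * + 1               ≡⟨ δ-free μ lam (δ _≟D_ u w) (x (arcLabel u w)) ⟩
        μ * δ _≟D_ u w + lam * x (arcLabel u w) + μ * (+ 1 - δ _≟D_ u w - x (arcLabel u w)) ∎
    }
    where
    δ-free : ∀ μ lam d a → (lam - μ) * a + μ * + 1 ≡ μ * d + lam * a + μ * (+ 1 - d - a)
    δ-free = solve-∀

mainTheorem10 : (n : ℕ) .{{_ : NonZero n}} (X : Subset n) → eC ∉ X →
    (μ lam t : ℤ) →
    IsDSRG _≟D_ elemsD (cayleyAdj X) (2 ℕ.* n) (+ (2 ℕ.* ∣ X ∣)) μ lam t
    ⇔ (t ≡ μ × (∀ k → ((bar X +ᶻ barInv X) *ᶻ bar X) k
                       ≡ (scaleᶻ (lam - μ) (bar X) +ᶻ scaleᶻ μ barC) k))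
mainTheorem10 n X e∉X μ lam t = mk⇔
  (λ G → dsrg⇒t≡μ X μ lam t e∉X G , dsrg⇒groupRingEquation X μ lam t G)
  (λ (t≡μ , equation) → groupRingEquation⇒dsrg X μ lam t t≡μ equation)
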